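{- Let $a,b,d$ be three pairwise coprime positive integers. Let $R_0=\{1,\dots,b-1\}\times\{ -(a-1),\dots,-1\}\subseteq\mathbb{Z}^2$ and $L=\{(x,y)\in\mathbb{Z}^2: ax+by\equiv0\pmod d\}$. Then $$g\Big(\frac{\langle a,b\rangle}{d}\Big)=\frac12\,\#(L\cap R_0).$$
   Context: $\langle a,b\rangle=\{xa+yb:x,y\in\mathbb{N}\}$; $S/d=\{x\in\mathbb{N}:dx\in S\}$; $g(S)=\#(\mathbb{N}\setminus S)$. -}

module Defs where

open import Data.Nat using (ℕ; suc; _+_; _*_; _∸_)
open import Data.Nat.Divisibility using (_∣?_)
open import Data.Integer as ℤ using (ℤ; +_; -_)
import Data.Integer.Divisibility as ℤDiv
open import Data.List using (List; length; filter; concatMap; map; upTo; applyUpTo)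
open import Data.List.Membership.Propositional using (_∈_)
open import Data.List.Relation.Unary.Unique.Propositional using (Unique)
open import Data.Product using (Σ; ∃; ∃-syntax; _×_; _,_; proj₁; proj₂)
open import Relation.Nullary using (¬_; Dec)
open import Relation.Unary using (Pred)
open import Level using (0ℓ)

_∈⟨_,_⟩ : ℕ → ℕ → ℕ → Set
n ∈⟨ a , b ⟩ = ∃[ x ] ∃[ y ] x * a + y * b ≡ n
  where open import Relation.Binary.PropositionalEquality using (_≡_)

_/_ : Pred ℕ 0ℓ → ℕ → Pred ℕ 0ℓ
(S / d) x = S (d * x)

⟨_,_⟩ : ℕ → ℕ → Pred ℕ 0ℓ
⟨ a , b ⟩ n = n ∈⟨ a , b ⟩

HasGenus : Pred ℕ 0ℓ → ℕ → Set
HasGenus S n = Σ (List ℕ) λ xs →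
  Unique xs × (∀ x → (x ∈ xs → ¬ S x) × (¬ S x → x ∈ xs)) × length xs ≡ n
  where open import Relation.Binary.PropositionalEquality using (_≡_)

R₀ : ℕ → ℕ → List (ℤ × ℤ)
R₀ a b = concatMap (λ i → map (λ j → (+ suc i , - (+ suc j))) (upTo (a ∸ 1))) (upTo (b ∸ 1))

InL : ℕ → ℕ → ℕ → ℤ × ℤ → Set
InL a b d (x , y) = (+ d) ℤDiv.∣ ((+ a) ℤ.* x ℤ.+ (+ b) ℤ.* y)

InL? : ∀ a b d p → Dec (InL a b d p)
InL? a b d (x , y) = d ∣? ℤ.∣ (+ a) ℤ.* x ℤ.+ (+ b) ℤ.* y ∣

#L∩R₀ : ℕ → ℕ → ℕ → ℕ
#L∩R₀ a b d = length (filter (InL? a b d) (R₀ a b))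

{-# OPTIONS --safe #-}
module Submission where

-- Write S = ⟨a,b⟩ and encode the point (i , -j) of R₀ as the pair (i , j). Since a and b are
-- coprime, every m ∉ S has exactly one representation m = a i - b j with 0 < i < b and 0 < j,
-- and then also j < a. Hence (i , j) ↦ (a i - b j) / d is a bijection from the points of L ∩ R₀ with
-- a i - b j > 0 onto the gaps of S / d, and the same holds with the roles of a and b swapped
-- for the points with a i - b j < 0. No point of R₀ has a i = b j, so #(L ∩ R₀) = 2 g(S / d).

open import Defs
open import Data.Nat using (ℕ; zero; suc; _+_; _*_; _∸_; _≤_; _<_; z≤n; z<s; s<s; NonZero; >-nonZero)
open import Data.Nat.Properties
open import Data.Nat.Divisibility using (_∣_; divides; _∣?_; ∣⇒≤; ∣m+n∣m⇒∣n; m∣m*n)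
open import Data.Nat.DivMod using (m≡m%n+[m/n]*n; m%n<n; m*[n/m]≡n; m*n/n≡m) renaming (_/_ to _div_; _%_ to _mod_)
open import Data.Nat.Coprimality as Coprime using (Coprime; coprime-divisor; coprime-Bézout)
open import Data.Nat.GCD using (module Bézout)
open import Data.Nat.Tactic.RingSolver using (solve)
open import Data.Integer as ℤ using (ℤ; _⊖_)
open import Data.Integer.Properties using (pos-*; neg-distribʳ-*; m-n≡m⊖n; ∣m⊖n∣≡∣n⊖m∣; ∣⊖∣-≤)
open import Data.List using (List; []; _∷_; _++_; length; filter; map; upTo; concatMap; cartesianProduct)
open import Data.List.Properties using (length-map; map-++; map-∘)
open import Data.List.Membership.Propositional using (_∈_)
open import Data.List.Membership.Propositional.Properties using (∈-map⁺; ∈-map⁻; ∈-filter⁺; ∈-filter⁻; ∈-upTo⁺; ∈-upTo⁻; ∈-cartesianProduct⁺; ∈-cartesianProduct⁻)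
open import Data.List.Membership.Propositional.Properties.WithK using (unique∧set⇒bag)
open import Data.List.Relation.Unary.Any using (here; there)
import Data.List.Relation.Unary.All as All
import Data.List.Relation.Unary.All.Properties as All
open import Data.List.Relation.Unary.Unique.Propositional using (Unique; []; _∷_)
open import Data.List.Relation.Unary.Unique.Propositional.Properties using (filter⁺; upTo⁺; cartesianProduct⁺) renaming (map⁺ to Unique-map⁺)
open import Data.List.Relation.Binary.BagAndSetEquality using (∼bag⇒↭)
open import Data.List.Relation.Binary.Permutation.Propositional.Properties using (↭-length)
open import Data.Empty using (⊥-elim)
open import Data.Product using (Σ; ∃-syntax; _×_; _,_; proj₁; proj₂; swap)
open import Data.Sum using (_⊎_; inj₁; inj₂; [_,_]′)
open import Function using (_∘_; _⇔_; mk⇔; Equivalence)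
open import Level using (0ℓ)
open import Relation.Binary using (tri<; tri≈; tri>)
open import Relation.Binary.PropositionalEquality using (_≡_; _≢_; refl; sym; trans; cong; cong₂; subst; module ≡-Reasoning)
open import Relation.Nullary using (¬_; yes; no; contradiction)
open import Relation.Nullary.Decidable using (_×-dec_)
open import Relation.Unary using (Pred; Decidable)

open Equivalence using (to; from)

private variable
  A B : Set
  a b d i i′ j j′ m n : ℕ
  xs ys : List A

Unique-map⁺-on : (f : A → B) → Unique xs → (∀ {x y} → x ∈ xs → y ∈ xs → f x ≡ f y → x ≡ y) →
  Unique (map f xs)
Unique-map⁺-on f []           _   = []
Unique-map⁺-on f (x∉xs ∷ xs!) inj =
  All.map⁺ (All.tabulate λ y∈xs fx≡fy → All.lookup x∉xs y∈xs (inj (here refl) (there y∈xs) fx≡fy))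
  ∷ Unique-map⁺-on f xs! (λ x∈ y∈ → inj (there x∈) (there y∈))

length-filter-map : {P : Pred B 0ℓ} (P? : Decidable P) (f : A → B) (xs : List A) →
  length (filter P? (map f xs)) ≡ length (filter (P? ∘ f) xs)
length-filter-map P? f []       = refl
length-filter-map P? f (x ∷ xs) with P? (f x)
... | yes _ = cong suc (length-filter-map P? f xs)
... | no _  = length-filter-map P? f xs

length-filter-⊎ : {P Q R : Pred A 0ℓ} (P? : Decidable P) (Q? : Decidable Q) (R? : Decidable R) →
  (∀ {x} → x ∈ xs → P x ⇔ (Q x ⊎ R x)) → (∀ {x} → Q x → ¬ R x) →
  length (filter P? xs) ≡ length (filter Q? xs) + length (filter R? xs)
length-filter-⊎ {xs = []}     P? Q? R? _ _ = refl
length-filter-⊎ {xs = x ∷ xs} P? Q? R? P⇔Q⊎R Q⇒¬R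
  with P? x | Q? x | R? x | length-filter-⊎ {xs = xs} P? Q? R? (P⇔Q⊎R ∘ there) Q⇒¬R
... | _      | yes q  | yes r  | _  = contradiction r (Q⇒¬R q)
... | yes _  | yes _  | no _   | ih = cong suc ih
... | yes _  | no _   | yes _  | ih = trans (cong suc ih) (sym (+-suc _ _))
... | yes p  | no ¬q  | no ¬r  | _  = ⊥-elim ([ ¬q , ¬r ]′ (to (P⇔Q⊎R (here refl)) p))
... | no ¬p  | yes q  | no _   | _  = contradiction (from (P⇔Q⊎R (here refl)) (inj₁ q)) ¬p
... | no ¬p  | no _   | yes r  | _  = contradiction (from (P⇔Q⊎R (here refl)) (inj₂ r)) ¬p
... | no _   | no _   | no _   | ih = ih

hasGenus-map : {S : Pred ℕ 0ℓ} (f : A → ℕ) → Unique ys →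
  (∀ {y y′} → y ∈ ys → y′ ∈ ys → f y ≡ f y′ → y ≡ y′) →
  (∀ {y} → y ∈ ys → ¬ S (f y)) → (∀ {x} → ¬ S x → ∃[ y ] y ∈ ys × f y ≡ x) →
  HasGenus S (length ys)
hasGenus-map {ys = ys} {S} f ys! inj gaps onto =
  map f ys , Unique-map⁺-on f ys! inj , (λ x → gap x , listed x) , length-map f ys
  where
    gap : ∀ x → x ∈ map f ys → ¬ S x
    gap x x∈ with ∈-map⁻ f x∈
    ... | y , y∈ , refl = gaps y∈
    listed : ∀ x → ¬ S x → x ∈ map f ys
    listed x x∉S with onto x∉S
    ... | y , y∈ , refl = ∈-map⁺ f y∈

hasGenus-unique : {S T : Pred ℕ 0ℓ} → (∀ x → S x ⇔ T x) → HasGenus S m → HasGenus T n → m ≡ n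
hasGenus-unique S⇔T (xs , xs! , xs≈∁S , refl) (ys , ys! , ys≈∁T , refl) =
  ↭-length (∼bag⇒↭ (unique∧set⇒bag xs! ys! (mk⇔ xs⊆ys ys⊆xs)))
  where
    xs⊆ys : ∀ {x} → x ∈ xs → x ∈ ys
    xs⊆ys {x} x∈ = proj₂ (ys≈∁T x) (proj₁ (xs≈∁S x) x∈ ∘ from (S⇔T x))
    ys⊆xs : ∀ {x} → x ∈ ys → x ∈ xs
    ys⊆xs {x} x∈ = proj₂ (xs≈∁S x) (proj₁ (ys≈∁T x) x∈ ∘ to (S⇔T x))

m+n≡o+p⇒m≡o+[p∸n] : ∀ {m n o p} → m + n ≡ o + p → n ≤ p → m ≡ o + (p ∸ n)
m+n≡o+p⇒m≡o+[p∸n] {m} {n} {o} {p} eq n≤p = begin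
  m            ≡⟨ m+n∸n≡m m n ⟨
  m + n ∸ n    ≡⟨ cong (_∸ n) eq ⟩
  o + p ∸ n    ≡⟨ +-∸-assoc o n≤p ⟩
  o + (p ∸ n)  ∎
  where open ≡-Reasoning

coprime-∣*-<⇒≡0 : ∀ {k} → Coprime b a → b ∣ a * k → k < b → k ≡ 0
coprime-∣*-<⇒≡0 {k = zero}  _ _     _   = refl
coprime-∣*-<⇒≡0 {k = suc _} c b∣a*k k<b = contradiction (∣⇒≤ (coprime-divisor c b∣a*k)) (<⇒≱ k<b)

linear-rep-unique-≤ : Coprime b a → i ≤ i′ → i′ < b → a * i + b * j ≡ a * i′ + b * j′ → i ≡ i′
linear-rep-unique-≤ {b} {a} {i} {i′} {j} {j′} c i≤i′ i′<b eq =
  ≤-antisym i≤i′ (m∸n≡0⇒m≤n (coprime-∣*-<⇒≡0 c b∣a*k (≤-<-trans (m∸n≤m i′ i) i′<b)))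
  where
    open ≡-Reasoning
    k = i′ ∸ i
    shift : a * i′ + b * j′ ≡ a * i + (b * j′ + a * k)
    shift = begin
      a * i′ + b * j′          ≡⟨ cong (λ t → a * t + b * j′) (m+[n∸m]≡n i≤i′) ⟨
      a * (i + k) + b * j′     ≡⟨ cong (_+ b * j′) (*-distribˡ-+ a i k) ⟩
      a * i + a * k + b * j′   ≡⟨ +-assoc (a * i) (a * k) (b * j′) ⟩
      a * i + (a * k + b * j′) ≡⟨ cong ((a * i) +_) (+-comm (a * k) (b * j′)) ⟩
      a * i + (b * j′ + a * k) ∎
    b∣a*k : b ∣ a * k
    b∣a*k = ∣m+n∣m⇒∣n (subst (b ∣_) (+-cancelˡ-≡ (a * i) _ _ (trans eq shift)) (m∣m*n j)) (m∣m*n j′)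

linear-rep-unique : Coprime b a → i < b → i′ < b → a * i + b * j ≡ a * i′ + b * j′ → i ≡ i′ × j ≡ j′
linear-rep-unique {b} {a} {i} {i′} {j} {j′} c i<b i′<b eq = i≡i′ , j≡j′
  where
    i≡i′ : i ≡ i′
    i≡i′ with ≤-total i i′
    ... | inj₁ i≤i′ = linear-rep-unique-≤ c i≤i′ i′<b eq
    ... | inj₂ i′≤i = sym (linear-rep-unique-≤ c i′≤i i<b (sym eq))
    instance
      b≢0 : NonZero b
      b≢0 = >-nonZero (≤-<-trans z≤n i<b)
    j≡j′ : j ≡ j′
    j≡j′ = *-cancelˡ-≡ j j′ b (+-cancelˡ-≡ (a * i) _ _ (trans eq (cong (λ t → a * t + b * j′) (sym i≡i′))))

∈⟨⟩-intro : ∀ x y → a * x + b * y ≡ n → n ∈⟨ a , b ⟩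
∈⟨⟩-intro {a} {b} x y eq = x , y , trans (cong₂ _+_ (*-comm x a) (*-comm y b)) eq

∈⟨⟩-comm : n ∈⟨ a , b ⟩ → n ∈⟨ b , a ⟩
∈⟨⟩-comm {a = a} {b} (x , y , eq) = y , x , trans (+-comm (y * b) (x * a)) eq

-- A gap m of ⟨a,b⟩ is represented by a pair (i , j) with m + b j ≡ a i, i.e. m = a i - b j.

gap-rep-unique : Coprime b a → i < b → i′ < b → m + b * j ≡ a * i → m + b * j′ ≡ a * i′ → i ≡ i′ × j ≡ j′
gap-rep-unique {b} {a} {i} {i′} {m} {j} {j′} c i<b i′<b eq eq′ =
  proj₁ same , sym (proj₂ same)
  where
    open ≡-Reasoning
    same = linear-rep-unique c i<b i′<b (begin
      a * i + b * j′      ≡⟨ cong (_+ b * j′) eq ⟨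
      m + b * j + b * j′  ≡⟨ solve (m ∷ b ∷ j ∷ j′ ∷ []) ⟩
      m + b * j′ + b * j  ≡⟨ cong (_+ b * j) eq′ ⟩
      a * i′ + b * j      ∎)

gap-rep⇒∉ : Coprime b a → i < b → 0 < j → m + b * j ≡ a * i → ¬ m ∈⟨ a , b ⟩
gap-rep⇒∉ {b} {a} {i} {j} {m} c i<b 0<j eq (u , v , u*a+v*b≡m) with ≤-total u i
... | inj₁ u≤i = contradiction (m+n≡0⇒n≡0 v (proj₂ (linear-rep-unique c (≤-<-trans u≤i i<b) i<b eq₀)))
                               (>⇒≢ 0<j)
  where
    open ≡-Reasoning
    eq₀ : a * u + b * (v + j) ≡ a * i + b * 0
    eq₀ = begin
      a * u + b * (v + j)      ≡⟨ solve (a ∷ u ∷ b ∷ v ∷ j ∷ []) ⟩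
      (u * a + v * b) + b * j  ≡⟨ cong (_+ b * j) u*a+v*b≡m ⟩
      m + b * j                ≡⟨ eq ⟩
      a * i                    ≡⟨ solve (a ∷ i ∷ b ∷ []) ⟩
      a * i + b * 0            ∎
... | inj₂ i≤u = <-irrefl refl (begin-strict
    a * i                    ≤⟨ *-monoʳ-≤ a i≤u ⟩
    a * u                    <⟨ m<m+n (a * u) (*-mono-≤ 0<b 0<j) ⟩
    a * u + b * j            ≤⟨ +-monoʳ-≤ (a * u) (m≤n+m (b * j) (v * b)) ⟩
    a * u + (v * b + b * j)  ≡⟨ solve (a ∷ u ∷ v ∷ b ∷ j ∷ []) ⟩
    (u * a + v * b) + b * j  ≡⟨ cong (_+ b * j) u*a+v*b≡m ⟩
    m + b * j                ≡⟨ eq ⟩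
    a * i                    ∎)
  where
    open ≤-Reasoning
    0<b : 0 < b
    0<b = ≤-<-trans z≤n i<b

∃-inverse-mod : Coprime a b → .{{NonZero b}} → ∃[ x ] ∃[ k ] ∃[ y ] a * x + b * k ≡ 1 + b * y
∃-inverse-mod {a} {b} c with coprime-Bézout c
... | Bézout.+- x y eq = x , 0 , y , (begin
  a * x + b * 0  ≡⟨ solve (a ∷ x ∷ b ∷ []) ⟩
  x * a          ≡⟨ eq ⟨
  1 + y * b      ≡⟨ cong (1 +_) (*-comm y b) ⟩
  1 + b * y      ∎)
  where open ≡-Reasoning
-- Here a x ≡ -1 (mod b); multiplying by b - 1 turns -1 into 1.
∃-inverse-mod {a} {b@(suc b-1)} c | Bézout.-+ x y eq = b-1 * x , 1 , b-1 * y , (begin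
  a * (b-1 * x) + b * 1    ≡⟨ solve (a ∷ b-1 ∷ x ∷ []) ⟩
  1 + b-1 * (1 + x * a)    ≡⟨ cong (λ t → 1 + b-1 * t) eq ⟩
  1 + b-1 * (y * b)        ≡⟨ solve (b-1 ∷ y ∷ []) ⟩
  1 + b * (b-1 * y)        ∎)
  where open ≡-Reasoning

∃-residue : Coprime a b → .{{NonZero b}} → ∀ m → ∃[ i ] ∃[ K ] ∃[ Y ] i < b × a * i + b * K ≡ m + b * Y
∃-residue {a} {b} c m with ∃-inverse-mod c
... | x , k , y , ax+bk≡1+by = r , a * q + m * k , m * y , m%n<n (m * x) b , (begin
  a * r + b * (a * q + m * k)    ≡⟨ regroup r q ⟩
  a * (r + q * b) + m * (b * k)  ≡⟨ cong (λ t → a * t + m * (b * k)) (m≡m%n+[m/n]*n (m * x) b) ⟨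
  a * (m * x) + m * (b * k)      ≡⟨ solve (a ∷ m ∷ x ∷ b ∷ k ∷ []) ⟩
  m * (a * x + b * k)            ≡⟨ cong (m *_) ax+bk≡1+by ⟩
  m * (1 + b * y)                ≡⟨ solve (m ∷ b ∷ y ∷ []) ⟩
  m + b * (m * y)                ∎)
  where
    open ≡-Reasoning
    r = (m * x) mod b
    q = (m * x) div b
    regroup : ∀ s t → a * s + b * (a * t + m * k) ≡ a * (s + t * b) + m * (b * k)
    regroup s t = solve (a ∷ s ∷ b ∷ t ∷ m ∷ k ∷ [])

∉⇒gap-rep : Coprime a b → .{{NonZero b}} → ¬ m ∈⟨ a , b ⟩ →
  ∃[ i ] ∃[ j ] i < b × 0 < j × m + b * j ≡ a * i
∉⇒gap-rep {a} {b} {m} c m∉ with ∃-residue c m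
... | i , K , Y , i<b , eq with Y ≤? K
...   | yes Y≤K = contradiction (∈⟨⟩-intro i (K ∸ Y) (sym (begin
          m                  ≡⟨ m+n≡o+p⇒m≡o+[p∸n] (sym eq) (*-monoʳ-≤ b Y≤K) ⟩
          a * i + (b * K ∸ b * Y) ≡⟨ cong (a * i +_) (*-distribˡ-∸ b K Y) ⟨
          a * i + b * (K ∸ Y) ∎))) m∉
  where open ≡-Reasoning
...   | no Y≰K = i , Y ∸ K , i<b , m<n⇒0<n∸m K<Y , sym (begin
          a * i                   ≡⟨ m+n≡o+p⇒m≡o+[p∸n] eq (*-monoʳ-≤ b (<⇒≤ K<Y)) ⟩
          m + (b * Y ∸ b * K)     ≡⟨ cong (m +_) (*-distribˡ-∸ b Y K) ⟨
          m + b * (Y ∸ K)         ∎)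
  where
    open ≡-Reasoning
    K<Y = ≰⇒> Y≰K

Box : ℕ → ℕ → Pred (ℕ × ℕ) 0ℓ
Box a b (i , j) = (0 < i × i < b) × (0 < j × j < a)

gap-rep⇒Box : b * j < a * i → i < b → 0 < j → Box a b (i , j)
gap-rep⇒Box {b} {j} {a} {zero} bj<a*0 _ _ = contradiction (subst (b * j <_) (*-zeroʳ a) bj<a*0) n≮0
gap-rep⇒Box {b} {j} {a} {suc i} bj<ai i<b 0<j = (z<s , i<b) , (0<j , j<a)
  where
    j<a : j < a
    j<a = *-cancelˡ-< b j a (begin-strict
      b * j        <⟨ bj<ai ⟩
      a * suc i    ≤⟨ *-monoʳ-≤ a (<⇒≤ i<b) ⟩
      a * b        ≡⟨ *-comm a b ⟩
      b * a        ∎)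
      where open ≤-Reasoning

Box⇒*≢* : Coprime b a → Box a b (i , j) → a * i ≢ b * j
Box⇒*≢* {b} {a} {i} {j} c ((0<i , i<b) , _) ai≡bj =
  >⇒≢ 0<i (coprime-∣*-<⇒≡0 c (divides j (trans ai≡bj (*-comm b j))) i<b)

InL⁺ : ℕ → ℕ → ℕ → Pred (ℕ × ℕ) 0ℓ
InL⁺ a b d (i , j) = b * j < a * i × d ∣ a * i ∸ b * j

InL⁺? : ∀ a b d → Decidable (InL⁺ a b d)
InL⁺? a b d (i , j) = (b * j <? a * i) ×-dec (d ∣? a * i ∸ b * j)

hasGenus-InL⁺ : Coprime a b → .{{NonZero b}} → .{{NonZero d}} →
  (R : List (ℕ × ℕ)) → Unique R → (∀ {p} → p ∈ R ⇔ Box a b p) →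
  HasGenus (⟨ a , b ⟩ / d) (length (filter (InL⁺? a b d) R))
hasGenus-InL⁺ {a} {b} {d} a⊥b R R! R≈Box =
  hasGenus-map gap (filter⁺ (InL⁺? a b d) R!) injective (λ p∈ → gap-rep⇒∉ b⊥a (i<b p∈) (0<j p∈) (rep p∈)) onto
  where
    b⊥a = Coprime.sym a⊥b
    F = filter (InL⁺? a b d) R
    gap : ℕ × ℕ → ℕ
    gap (i , j) = (a * i ∸ b * j) div d
    facts : ∀ {p} → p ∈ F → Box a b p × InL⁺ a b d p
    facts p∈ with ∈-filter⁻ (InL⁺? a b d) {xs = R} p∈
    ... | p∈R , inL = to R≈Box p∈R , inL
    i<b : ∀ {i j} → (i , j) ∈ F → i < b
    i<b p∈ = proj₂ (proj₁ (proj₁ (facts p∈)))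
    0<j : ∀ {i j} → (i , j) ∈ F → 0 < j
    0<j p∈ = proj₁ (proj₂ (proj₁ (facts p∈)))
    rep : ∀ {i j} → (i , j) ∈ F → d * gap (i , j) + b * j ≡ a * i
    rep {i} {j} p∈ with facts p∈
    ... | _ , bj<ai , d∣ = trans (cong (_+ b * j) (m*[n/m]≡n d∣)) (m∸n+n≡m (<⇒≤ bj<ai))
    injective : ∀ {p q} → p ∈ F → q ∈ F → gap p ≡ gap q → p ≡ q
    injective {i , j} {i′ , j′} p∈ q∈ same-gap =
      cong₂ _,_ (proj₁ same-rep) (proj₂ same-rep)
      where
        same-rep = gap-rep-unique b⊥a (i<b p∈) (i<b q∈) (rep p∈)
                     (subst (λ g → d * g + b * j′ ≡ a * i′) (sym same-gap) (rep q∈))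
    onto : ∀ {x} → ¬ (d * x) ∈⟨ a , b ⟩ → ∃[ p ] p ∈ F × gap p ≡ x
    onto {x} dx∉ with ∉⇒gap-rep a⊥b dx∉
    ... | i , j , i<b , 0<j , eq =
      (i , j) , ∈-filter⁺ (InL⁺? a b d) (from R≈Box (gap-rep⇒Box bj<ai i<b 0<j)) (bj<ai , divides x dx) ,
      trans (cong (_div d) dx) (m*n/n≡m x d)
      where
        0<dx : 0 < d * x
        0<dx = n≢0⇒n>0 (λ dx≡0 → dx∉ (0 , 0 , sym dx≡0))
        bj<ai : b * j < a * i
        bj<ai = subst (b * j <_) eq (m<n+m (b * j) 0<dx)
        dx : a * i ∸ b * j ≡ x * d
        dx = trans (cong (_∸ b * j) (sym eq)) (trans (m+n∸n≡m (d * x) (b * j)) (*-comm d x))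

positivesBelow : ℕ → List ℕ
positivesBelow n = map suc (upTo (n ∸ 1))

∈-positivesBelow : i ∈ positivesBelow n ⇔ (0 < i × i < n)
∈-positivesBelow = mk⇔ ⇒ ⇐
  where
    ⇒ : i ∈ positivesBelow n → 0 < i × i < n
    ⇒ {n = suc _} i∈ with ∈-map⁻ suc i∈
    ... | k , k∈ , refl = z<s , s<s (∈-upTo⁻ k∈)
    ⇐ : 0 < i × i < n → i ∈ positivesBelow n
    ⇐ {suc _} {suc _} (_ , s<s i<n) = ∈-map⁺ suc (∈-upTo⁺ i<n)

box : ℕ → ℕ → List (ℕ × ℕ)
box a b = cartesianProduct (positivesBelow b) (positivesBelow a)

box-unique : ∀ a b → Unique (box a b)
box-unique a b = cartesianProduct⁺ (Unique-map⁺ suc-injective (upTo⁺ (b ∸ 1)))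
                                   (Unique-map⁺ suc-injective (upTo⁺ (a ∸ 1)))

∈-box : ∀ {p} → p ∈ box a b ⇔ Box a b p
∈-box {a} {b} {i , j} = mk⇔
  (λ p∈ → let i∈ , j∈ = ∈-cartesianProduct⁻ (positivesBelow b) (positivesBelow a) p∈
          in to ∈-positivesBelow i∈ , to ∈-positivesBelow j∈)
  (λ (i∈ , j∈) → ∈-cartesianProduct⁺ (from ∈-positivesBelow i∈) (from ∈-positivesBelow j∈))

∈-swap-box : ∀ {p} → p ∈ map swap (box a b) ⇔ Box b a p
∈-swap-box {a} {b} = mk⇔
  (λ p∈ → let q , q∈ , p≡ = ∈-map⁻ swap p∈ in subst (Box b a) (sym p≡) (swap (to ∈-box q∈)))
  (λ box-p → ∈-map⁺ swap (from ∈-box (swap box-p)))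

point : ℕ × ℕ → ℤ × ℤ
point (i , j) = (ℤ.+ i , ℤ.- ℤ.+ j)

map-point-box : ∀ a b → map point (box a b) ≡ R₀ a b
map-point-box a b = go (upTo (b ∸ 1))
  where
    js = upTo (a ∸ 1)
    go : ∀ is → map point (cartesianProduct (map suc is) (map suc js))
              ≡ concatMap (λ i → map (λ j → (ℤ.+ suc i , ℤ.- ℤ.+ suc j)) js) is
    go []       = refl
    go (i ∷ is) = trans (map-++ point (map (suc i ,_) (map suc js)) _) (cong₂ _++_ row (go is))
      where
        row : map point (map (suc i ,_) (map suc js)) ≡ map (λ j → (ℤ.+ suc i , ℤ.- ℤ.+ suc j)) js
        row = sym (trans (map-∘ {g = point ∘ (suc i ,_)} {f = suc} js) (map-∘ (map suc js)))

∣⊖∣-split : m ≢ n → d ∣ ℤ.∣ m ⊖ n ∣ ⇔ ((n < m × d ∣ m ∸ n) ⊎ (m < n × d ∣ n ∸ m))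
∣⊖∣-split {m} {n} {d} m≢n with <-cmp m n
... | tri< m<n _ _ = mk⇔ (λ d∣ → inj₂ (m<n , subst (d ∣_) e d∣))
    [ (λ (n<m , _) → contradiction n<m (<-asym m<n)) , (λ (_ , d∣) → subst (d ∣_) (sym e) d∣) ]′
  where e = ∣⊖∣-≤ (<⇒≤ m<n)
... | tri≈ _ m≡n _ = contradiction m≡n m≢n
... | tri> _ _ n<m = mk⇔ (λ d∣ → inj₁ (n<m , subst (d ∣_) e d∣))
    [ (λ (_ , d∣) → subst (d ∣_) (sym e) d∣) , (λ (m<n , _) → contradiction m<n (<-asym n<m)) ]′
  where e = trans (∣m⊖n∣≡∣n⊖m∣ m n) (∣⊖∣-≤ (<⇒≤ n<m))

∣ai-bj∣≡∣ai⊖bj∣ : ℤ.∣ (ℤ.+ a) ℤ.* (ℤ.+ i) ℤ.+ (ℤ.+ b) ℤ.* (ℤ.- ℤ.+ j) ∣ ≡ ℤ.∣ a * i ⊖ b * j ∣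
∣ai-bj∣≡∣ai⊖bj∣ {a} {i} {b} {j} = cong ℤ.∣_∣ (begin
  ℤ.+ a ℤ.* ℤ.+ i ℤ.+ ℤ.+ b ℤ.* ℤ.- ℤ.+ j  ≡⟨ cong₂ ℤ._+_ (pos-* a i) (neg-distribʳ-* (ℤ.+ b) (ℤ.+ j)) ⟨
  ℤ.+ (a * i) ℤ.+ ℤ.- (ℤ.+ b ℤ.* ℤ.+ j)   ≡⟨ cong (λ t → ℤ.+ (a * i) ℤ.+ ℤ.- t) (pos-* b j) ⟨
  ℤ.+ (a * i) ℤ.+ ℤ.- ℤ.+ (b * j)         ≡⟨ m-n≡m⊖n (a * i) (b * j) ⟩
  a * i ⊖ b * j                           ∎)
  where open ≡-Reasoning

InL-point⇔ : a * i ≢ b * j → InL a b d (point (i , j)) ⇔ (InL⁺ a b d (i , j) ⊎ InL⁺ b a d (j , i))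
InL-point⇔ {a} {i} {b} {j} {d} ai≢bj =
  subst (λ n → d ∣ n ⇔ (InL⁺ a b d (i , j) ⊎ InL⁺ b a d (j , i))) (sym (∣ai-bj∣≡∣ai⊖bj∣ {a} {i} {b} {j}))
        (∣⊖∣-split ai≢bj)

InL⁺-asym : ∀ {p} → InL⁺ a b d p → ¬ InL⁺ b a d (swap p)
InL⁺-asym {p = i , j} (bj<ai , _) (ai<bj , _) = <-asym bj<ai ai<bj

#L∩R₀-split : ∀ a b d → Coprime a b →
  #L∩R₀ a b d ≡ length (filter (InL⁺? a b d) (box a b)) + length (filter (InL⁺? b a d ∘ swap) (box a b))
#L∩R₀-split a b d a⊥b = begin
  #L∩R₀ a b d                                         ≡⟨ cong (length ∘ filter (InL? a b d)) (map-point-box a b) ⟨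
  length (filter (InL? a b d) (map point (box a b)))  ≡⟨ length-filter-map (InL? a b d) point (box a b) ⟩
  length (filter (InL? a b d ∘ point) (box a b))      ≡⟨ length-filter-⊎ (InL? a b d ∘ point) (InL⁺? a b d)
                                                           (InL⁺? b a d ∘ swap) point⇔ (InL⁺-asym {a} {b} {d}) ⟩
  length (filter (InL⁺? a b d) (box a b)) + length (filter (InL⁺? b a d ∘ swap) (box a b))  ∎
  where
    open ≡-Reasoning
    point⇔ : ∀ {p} → p ∈ box a b → InL a b d (point p) ⇔ (InL⁺ a b d p ⊎ InL⁺ b a d (swap p))
    point⇔ {i , j} p∈ = InL-point⇔ {a} {i} {b} {j} (Box⇒*≢* (Coprime.sym a⊥b) (to ∈-box p∈))

#InL⁺-mirror : Coprime a b → .{{NonZero a}} → .{{NonZero b}} → .{{NonZero d}} →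
  length (filter (InL⁺? b a d ∘ swap) (box a b)) ≡ length (filter (InL⁺? a b d) (box a b))
#InL⁺-mirror {a} {b} {d} a⊥b = begin
  length (filter (InL⁺? b a d ∘ swap) (box a b))   ≡⟨ length-filter-map (InL⁺? b a d) swap (box a b) ⟨
  length (filter (InL⁺? b a d) (map swap (box a b))) ≡⟨ hasGenus-unique (λ _ → mk⇔ ∈⟨⟩-comm ∈⟨⟩-comm) genus-ba genus-ab ⟩
  length (filter (InL⁺? a b d) (box a b))          ∎
  where
    open ≡-Reasoning
    genus-ab = hasGenus-InL⁺ a⊥b (box a b) (box-unique a b) ∈-box
    genus-ba = hasGenus-InL⁺ (Coprime.sym a⊥b) (map swap (box a b))
                 (Unique-map⁺ (cong swap) (box-unique a b)) ∈-swap-box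

proposition1 : (a b d : ℕ) → 1 ≤ a → 1 ≤ b → 1 ≤ d →
    Coprime a b → Coprime a d → Coprime b d →
    Σ ℕ (λ g → HasGenus (⟨ a , b ⟩ / d) g × 2 * g ≡ #L∩R₀ a b d)
proposition1 a@(suc _) b@(suc _) d@(suc _) _ _ _ a⊥b _ _ =
  g , hasGenus-InL⁺ a⊥b (box a b) (box-unique a b) ∈-box , (begin
    g + (g + 0)  ≡⟨ cong (g +_) (+-identityʳ g) ⟩
    g + g        ≡⟨ cong (g +_) (#InL⁺-mirror a⊥b) ⟨
    g + g′       ≡⟨ #L∩R₀-split a b d a⊥b ⟨
    #L∩R₀ a b d  ∎)
  where
    open ≡-Reasoning
    g  = length (filter (InL⁺? a b d) (box a b))
    g′ = length (filter (InL⁺? b a d ∘ swap) (box a b))
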